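{- For every integer $n$ with $4\le n\le 6$, $K_{3,n}$ admits a rigid orientation. For every integer $n$ with $5\le n\le 13$, $K_{4,n}$ admits a rigid orientation.
   Context: $K_{m,n}$ is the complete bipartite graph with parts of sizes $m$ and $n$. An orientation assigns one direction to each edge. An automorphism of an oriented graph is a permutation $\phi$ of its vertices such that $\phi(u)\phi(v)$ is an arc whenever $uv$ is an arc; the oriented graph is rigid if its only automorphism is the identity. -}

module Defs where

open import Data.Nat using (ℕ)
open import Data.Fin using (Fin)
open import Data.Bool using (Bool; true; false)
open import Data.Sum using (_⊎_; inj₁; inj₂)
open import Data.Empty using (⊥)
open import Data.Unit using (⊤)
open import Data.Product using (Σ)
open import Function.Bundles using (_↔_; Inverse)
open import Relation.Binary.PropositionalEquality using (_≡_)

Vertex : ℕ → ℕ → Set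
Vertex m n = Fin m ⊎ Fin n

-- An orientation of K_{m,n}: for each edge {i, j} (i on the left, j on
-- the right) choose a direction; true means the arc i → j, false means j → i.
Orientation : ℕ → ℕ → Set
Orientation m n = Fin m → Fin n → Bool

Arc : ∀ {m n} → Orientation m n → Vertex m n → Vertex m n → Set
Arc o (inj₁ i) (inj₂ j) = o i j ≡ true
Arc o (inj₂ j) (inj₁ i) = o i j ≡ false
Arc o (inj₁ _) (inj₁ _) = ⊥
Arc o (inj₂ _) (inj₂ _) = ⊥

IsAutomorphism : ∀ {m n} → Orientation m n → (Vertex m n ↔ Vertex m n) → Set
IsAutomorphism o φ =
  ∀ u v → Arc o u v → Arc o (Inverse.to φ u) (Inverse.to φ v)

Rigid : ∀ {m n} → Orientation m n → Set
Rigid {m} {n} o =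
  (φ : Vertex m n ↔ Vertex m n) → IsAutomorphism o φ →
  ∀ u → Inverse.to φ u ≡ u

AdmitsRigidOrientation : ℕ → ℕ → Set
AdmitsRigidOrientation m n = Σ (Orientation m n) Rigid

module Submission where

-- An orientation of K_{m,n} is an m × n Boolean matrix; column j records
-- the directions of the edges at the right vertex j.  Every left–right pair is an edge, so an
--    automorphism either keeps both parts or swaps them.  If 0 < m < n a swap
--    would inject the right part into the left one, so every automorphism is
--    a pair of relabellings (f, g) of rows and columns with o i j ≡ o (f i) (g j).
--  * A combinatorial rigidity criterion.  If the columns are pairwise distinct
--    and the only injective row relabelling sending every column to some column
--    is the identity, then such a pair (f, g) is trivial: first f = id, and
--    then g = id because the columns are distinct.
--  * Decidability.  The criterion quantifies only over finite sets (row
--    relabellings are functions Fin m → Fin m), so it is decidable, and it is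
--    confirmed by evaluation for one explicit matrix per case of the theorem.

open import Defs
open import Data.Nat using (ℕ; zero; suc; _≤_; _<_; _<?_; s≤s)
open import Data.Fin using (Fin; zero; suc; _≟_; fromℕ<)
open import Data.Fin.Properties using (all?; any?; <⇒notInjective)
open import Data.Bool using (Bool; true; false; not)
import Data.Bool.Properties as Bool
open import Data.Empty using (⊥-elim)
open import Data.Sum using (inj₁; inj₂; [_,_])
open import Data.Sum.Properties using (inj₁-injective; inj₂-injective)
open import Data.Product using (Σ; ∃; _×_; _,_; proj₁; proj₂)
open import Data.Vec using (Vec; []; _∷_; lookup)
import Data.Vec.Functional as Vector
open import Function using (_∘_)
open import Function.Bundles using (_↔_; Inverse; Injection)
open import Function.Properties.Inverse using (↔⇒↣)
open import Relation.Binary.PropositionalEquality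
  using (_≡_; _≗_; refl; sym; trans; cong; subst₂)
open import Relation.Nullary using (Dec; ¬_)
open import Relation.Nullary.Decidable
  using (True; toWitness; map′; _×-dec_; _→-dec_)

-- Deciding a property of all functions Fin k → Fin m, by splitting a function
-- into its value at zero and its tail; the property must not distinguish
-- pointwise equal functions, since function extensionality is unavailable.
∀-functions? : ∀ {m} k {P : (Fin k → Fin m) → Set} →
               (∀ {f g} → f ≗ g → P f → P g) →
               (∀ f → Dec (P f)) → Dec (∀ f → P f)
∀-functions? {m} zero resp P? =
  map′ (λ p f → resp (λ ()) p) (λ all → all empty) (P? empty)
  where
  empty : Fin 0 → Fin m
  empty ()
∀-functions? {m} (suc k) resp P? =
  map′ (λ all f → resp (head∷tail f) (all (f zero) (f ∘ suc)))
       (λ all x f → all (x Vector.∷ f))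
       (all? λ x → ∀-functions? k (resp ∘ cons-cong) (P? ∘ (x Vector.∷_)))
  where
  head∷tail : (f : Fin (suc k) → Fin m) → (f zero Vector.∷ (f ∘ suc)) ≗ f
  head∷tail f zero    = refl
  head∷tail f (suc _) = refl
  cons-cong : ∀ {x} {f g : Fin k → Fin m} → f ≗ g → (x Vector.∷ f) ≗ (x Vector.∷ g)
  cons-cong eq zero    = refl
  cons-cong eq (suc i) = eq i

not-swap : ∀ {x y} → x ≡ not y → y ≡ not x
not-swap {x} {y} eq = trans (sym (Bool.not-involutive y)) (cong not (sym eq))

module _ {m n : ℕ} (o : Orientation m n) where

  ColumnsDistinct : Set
  ColumnsDistinct = ∀ j j' → (∀ i → o i j ≡ o i j') → j ≡ j'

  -- Injectivity of a map on rows, in a form that can be decided by enumeration.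
  RowInjective : (Fin m → Fin m) → Set
  RowInjective f = ∀ i i' → f i ≡ f i' → i ≡ i'

  MapsColumnsToColumns : (Fin m → Fin m) → Set
  MapsColumnsToColumns f = ∀ j → ∃ λ j' → ∀ i → o i j ≡ o (f i) j'

  TrivialRowSymmetry : (Fin m → Fin m) → Set
  TrivialRowSymmetry f = RowInjective f → MapsColumnsToColumns f → ∀ i → f i ≡ i

  Criterion : Set
  Criterion = ColumnsDistinct × (∀ f → TrivialRowSymmetry f)

  isLeft : Vertex m n → Bool
  isLeft (inj₁ _) = true
  isLeft (inj₂ _) = false

  left-vertex : ∀ u → isLeft u ≡ true → Σ (Fin m) λ i → u ≡ inj₁ i
  left-vertex (inj₁ i) _ = i , refl

  right-vertex : ∀ u → isLeft u ≡ false → Σ (Fin n) λ j → u ≡ inj₂ j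
  right-vertex (inj₂ j) _ = j , refl

  arc-crosses : ∀ u v → Arc o u v → isLeft u ≡ not (isLeft v)
  arc-crosses (inj₁ _) (inj₂ _) _ = refl
  arc-crosses (inj₂ _) (inj₁ _) _ = refl

  record Relabelling (φ : Vertex m n ↔ Vertex m n) : Set where
    field
      rows        : Fin m → Fin m
      columns     : Fin n → Fin n
      acts        : ∀ u → Inverse.to φ u ≡ [ inj₁ ∘ rows , inj₂ ∘ columns ] u
      rows-inj    : RowInjective rows
      preserves-o : ∀ i j → o i j ≡ o (rows i) (columns j)

  module _ (φ : Vertex m n ↔ Vertex m n) (aut : IsAutomorphism o φ) where
    private
      to : Vertex m n → Vertex m n
      to = Inverse.to φ
      to-inj : ∀ {u v} → to u ≡ to v → u ≡ v
      to-inj = Injection.injective (↔⇒↣ φ)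

    edge-images-cross : ∀ i j → isLeft (to (inj₁ i)) ≡ not (isLeft (to (inj₂ j)))
    edge-images-cross i j with o i j in eq
    ... | true  = arc-crosses _ _ (aut (inj₁ i) (inj₂ j) eq)
    ... | false = not-swap (arc-crosses _ _ (aut (inj₂ j) (inj₁ i) eq))

    -- If a left vertex went to the right part, all right vertices would go
    -- injectively into the left part, which is smaller.
    no-swap : m < n → ∀ i → ¬ (isLeft (to (inj₁ i)) ≡ false)
    no-swap m<n i₀ swapped = <⇒notInjective m<n h-inj
      where
      to-left : ∀ j → isLeft (to (inj₂ j)) ≡ true
      to-left j = Bool.not-injective (trans (sym (edge-images-cross i₀ j)) swapped)
      h : Fin n → Fin m
      h j = proj₁ (left-vertex _ (to-left j))
      h-inj : ∀ {j j'} → h j ≡ h j' → j ≡ j'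
      h-inj {j} {j'} eq = inj₂-injective (to-inj (trans (image j)
                            (trans (cong inj₁ eq) (sym (image j')))))
        where
        image : ∀ j → to (inj₂ j) ≡ inj₁ (h j)
        image j = proj₂ (left-vertex _ (to-left j))

    -- Hence both parts are preserved; for the right part we use that some
    -- left vertex exists, adjacent to all right vertices.
    stays-left : m < n → ∀ i → isLeft (to (inj₁ i)) ≡ true
    stays-left m<n i with isLeft (to (inj₁ i)) in e
    ... | true  = refl
    ... | false = ⊥-elim (no-swap m<n i e)

    stays-right : 0 < m → m < n → ∀ j → isLeft (to (inj₂ j)) ≡ false
    stays-right 0<m m<n j = Bool.not-injective
      (trans (sym (edge-images-cross (fromℕ< 0<m) j)) (stays-left m<n _))

    automorphism⇒relabelling : 0 < m → m < n → Relabelling φ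
    automorphism⇒relabelling 0<m m<n = record
      { rows = rows ; columns = columns ; acts = acts
      ; rows-inj = rows-inj ; preserves-o = preserves-o }
      where
      rows : Fin m → Fin m
      rows i = proj₁ (left-vertex _ (stays-left m<n i))
      columns : Fin n → Fin n
      columns j = proj₁ (right-vertex _ (stays-right 0<m m<n j))
      acts : ∀ u → to u ≡ [ inj₁ ∘ rows , inj₂ ∘ columns ] u
      acts (inj₁ i) = proj₂ (left-vertex _ (stays-left m<n i))
      acts (inj₂ j) = proj₂ (right-vertex _ (stays-right 0<m m<n j))
      rows-inj : RowInjective rows
      rows-inj i i' eq = inj₁-injective
        (to-inj (trans (acts (inj₁ i)) (trans (cong inj₁ eq) (sym (acts (inj₁ i'))))))
      preserves-o : ∀ i j → o i j ≡ o (rows i) (columns j)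
      preserves-o i j with o i j in eq
      ... | true  = sym (subst₂ (Arc o) (acts (inj₁ i)) (acts (inj₂ j)) (aut (inj₁ i) (inj₂ j) eq))
      ... | false = sym (subst₂ (Arc o) (acts (inj₂ j)) (acts (inj₁ i)) (aut (inj₂ j) (inj₁ i) eq))

  -- Under the criterion the only relabelling is the identity: f = id because
  -- f sends each column j to column g j, and then g = id as columns are distinct.
  relabelling-trivial : Criterion → ∀ {φ} → Relabelling φ → ∀ u → Inverse.to φ u ≡ u
  relabelling-trivial (distinct , trivial) r u = trans (acts u) (identity u)
    where
    open Relabelling r
    rows-id : ∀ i → rows i ≡ i
    rows-id = trivial rows rows-inj (λ j → columns j , λ i → preserves-o i j)
    columns-id : ∀ j → columns j ≡ j
    columns-id j = sym (distinct j (columns j) λ i →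
      trans (preserves-o i j) (cong (λ i' → o i' (columns j)) (rows-id i)))
    identity : ∀ u → [ inj₁ ∘ rows , inj₂ ∘ columns ] u ≡ u
    identity (inj₁ i) = cong inj₁ (rows-id i)
    identity (inj₂ j) = cong inj₂ (columns-id j)

  criterion⇒rigid : 0 < m → m < n → Criterion → Rigid o
  criterion⇒rigid 0<m m<n criterion φ aut =
    relabelling-trivial criterion (automorphism⇒relabelling φ aut 0<m m<n)

  trivial-respects-≗ : ∀ {f g} → f ≗ g → TrivialRowSymmetry f → TrivialRowSymmetry g
  trivial-respects-≗ {f} {g} f≗g trivial g-inj g-perm i =
    trans (sym (f≗g i)) (trivial f-inj f-perm i)
    where
    f-inj : RowInjective f
    f-inj i i' eq = g-inj i i' (trans (sym (f≗g i)) (trans eq (f≗g i')))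
    f-perm : MapsColumnsToColumns f
    f-perm j with g-perm j
    ... | j' , same = j' , λ i → trans (same i) (cong (λ x → o x j') (sym (f≗g i)))

  criterion? : Dec Criterion
  criterion? = distinct? ×-dec ∀-functions? m trivial-respects-≗ trivial?
    where
    distinct? : Dec ColumnsDistinct
    distinct? = all? λ j → all? λ j' → all? (λ i → o i j Bool.≟ o i j') →-dec (j ≟ j')
    trivial? : ∀ f → Dec (TrivialRowSymmetry f)
    trivial? f = injective? →-dec (permutes? →-dec all? λ i → f i ≟ i)
      where
      injective? : Dec (RowInjective f)
      injective? = all? λ i → all? λ i' → (f i ≟ f i') →-dec (i ≟ i')
      permutes? : Dec (MapsColumnsToColumns f)
      permutes? = all? λ j → any? λ j' → all? λ i → o i j Bool.≟ o (f i) j'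

fromColumns : ∀ {m n} → Vec (Vec Bool m) n → Orientation m n
fromColumns table i j = lookup (lookup table j) i

rigid-by-evaluation : ∀ {m n} (table : Vec (Vec Bool m) n) →
                      {True (0 <? m)} → {True (m <? n)} →
                      {True (criterion? (fromColumns table))} →
                      AdmitsRigidOrientation m n
rigid-by-evaluation table {0<m} {m<n} {criterion} =
  fromColumns table ,
  criterion⇒rigid _ (toWitness 0<m) (toWitness m<n) (toWitness criterion)

-- Rigid orientations of K₃,ₙ and K₄,ₙ, given column by column; entry T in
-- row i of column j means the arc i → j, entry F the arc j → i.

private
  T F : Bool
  T = true
  F = false

K3-4 : AdmitsRigidOrientation 3 4
K3-4 = rigid-by-evaluation
  ( (F ∷ T ∷ T ∷ [])
  ∷ (F ∷ T ∷ F ∷ [])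
  ∷ (F ∷ F ∷ F ∷ [])
  ∷ (T ∷ T ∷ T ∷ [])
  ∷ [] )

K3-5 : AdmitsRigidOrientation 3 5
K3-5 = rigid-by-evaluation
  ( (T ∷ F ∷ F ∷ [])
  ∷ (T ∷ F ∷ T ∷ [])
  ∷ (F ∷ T ∷ F ∷ [])
  ∷ (T ∷ T ∷ T ∷ [])
  ∷ (F ∷ F ∷ F ∷ [])
  ∷ [] )

K3-6 : AdmitsRigidOrientation 3 6
K3-6 = rigid-by-evaluation
  ( (T ∷ T ∷ T ∷ [])
  ∷ (T ∷ T ∷ F ∷ [])
  ∷ (T ∷ F ∷ T ∷ [])
  ∷ (F ∷ T ∷ F ∷ [])
  ∷ (T ∷ F ∷ F ∷ [])
  ∷ (F ∷ F ∷ F ∷ [])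
  ∷ [] )

K4-5 : AdmitsRigidOrientation 4 5
K4-5 = rigid-by-evaluation
  ( (T ∷ F ∷ F ∷ F ∷ [])
  ∷ (T ∷ F ∷ T ∷ T ∷ [])
  ∷ (F ∷ T ∷ F ∷ T ∷ [])
  ∷ (T ∷ T ∷ F ∷ F ∷ [])
  ∷ (T ∷ T ∷ T ∷ F ∷ [])
  ∷ [] )

K4-6 : AdmitsRigidOrientation 4 6
K4-6 = rigid-by-evaluation
  ( (F ∷ F ∷ T ∷ F ∷ [])
  ∷ (F ∷ T ∷ T ∷ T ∷ [])
  ∷ (T ∷ T ∷ F ∷ F ∷ [])
  ∷ (F ∷ T ∷ F ∷ F ∷ [])
  ∷ (F ∷ F ∷ F ∷ F ∷ [])
  ∷ (T ∷ F ∷ T ∷ T ∷ [])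
  ∷ [] )

K4-7 : AdmitsRigidOrientation 4 7
K4-7 = rigid-by-evaluation
  ( (T ∷ F ∷ T ∷ F ∷ [])
  ∷ (F ∷ F ∷ T ∷ F ∷ [])
  ∷ (F ∷ T ∷ T ∷ F ∷ [])
  ∷ (T ∷ T ∷ T ∷ T ∷ [])
  ∷ (F ∷ F ∷ F ∷ F ∷ [])
  ∷ (F ∷ F ∷ F ∷ T ∷ [])
  ∷ (T ∷ F ∷ F ∷ F ∷ [])
  ∷ [] )

K4-8 : AdmitsRigidOrientation 4 8
K4-8 = rigid-by-evaluation
  ( (F ∷ T ∷ T ∷ T ∷ [])
  ∷ (T ∷ T ∷ F ∷ F ∷ [])
  ∷ (T ∷ F ∷ F ∷ F ∷ [])
  ∷ (F ∷ F ∷ T ∷ T ∷ [])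
  ∷ (F ∷ T ∷ T ∷ F ∷ [])
  ∷ (T ∷ F ∷ T ∷ F ∷ [])
  ∷ (F ∷ F ∷ F ∷ F ∷ [])
  ∷ (T ∷ T ∷ T ∷ T ∷ [])
  ∷ [] )

K4-9 : AdmitsRigidOrientation 4 9
K4-9 = rigid-by-evaluation
  ( (T ∷ T ∷ T ∷ F ∷ [])
  ∷ (T ∷ F ∷ F ∷ T ∷ [])
  ∷ (F ∷ T ∷ F ∷ T ∷ [])
  ∷ (F ∷ T ∷ F ∷ F ∷ [])
  ∷ (F ∷ F ∷ T ∷ F ∷ [])
  ∷ (T ∷ F ∷ T ∷ T ∷ [])
  ∷ (F ∷ F ∷ F ∷ F ∷ [])
  ∷ (T ∷ T ∷ F ∷ T ∷ [])
  ∷ (F ∷ T ∷ T ∷ T ∷ [])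
  ∷ [] )

K4-10 : AdmitsRigidOrientation 4 10
K4-10 = rigid-by-evaluation
  ( (F ∷ T ∷ F ∷ T ∷ [])
  ∷ (F ∷ F ∷ F ∷ F ∷ [])
  ∷ (T ∷ F ∷ F ∷ F ∷ [])
  ∷ (F ∷ T ∷ T ∷ T ∷ [])
  ∷ (T ∷ T ∷ T ∷ T ∷ [])
  ∷ (F ∷ F ∷ F ∷ T ∷ [])
  ∷ (F ∷ F ∷ T ∷ T ∷ [])
  ∷ (T ∷ F ∷ T ∷ T ∷ [])
  ∷ (T ∷ T ∷ T ∷ F ∷ [])
  ∷ (T ∷ F ∷ F ∷ T ∷ [])
  ∷ [] )

K4-11 : AdmitsRigidOrientation 4 11
K4-11 = rigid-by-evaluation
  ( (T ∷ T ∷ T ∷ F ∷ [])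
  ∷ (T ∷ T ∷ F ∷ T ∷ [])
  ∷ (T ∷ F ∷ F ∷ F ∷ [])
  ∷ (T ∷ T ∷ F ∷ F ∷ [])
  ∷ (F ∷ T ∷ T ∷ T ∷ [])
  ∷ (T ∷ F ∷ T ∷ T ∷ [])
  ∷ (T ∷ T ∷ T ∷ T ∷ [])
  ∷ (F ∷ F ∷ T ∷ T ∷ [])
  ∷ (F ∷ F ∷ T ∷ F ∷ [])
  ∷ (F ∷ T ∷ T ∷ F ∷ [])
  ∷ (F ∷ T ∷ F ∷ F ∷ [])
  ∷ [] )

K4-12 : AdmitsRigidOrientation 4 12
K4-12 = rigid-by-evaluation
  ( (F ∷ T ∷ T ∷ F ∷ [])
  ∷ (F ∷ F ∷ F ∷ F ∷ [])
  ∷ (T ∷ F ∷ F ∷ T ∷ [])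
  ∷ (F ∷ F ∷ T ∷ T ∷ [])
  ∷ (F ∷ F ∷ F ∷ T ∷ [])
  ∷ (T ∷ F ∷ F ∷ F ∷ [])
  ∷ (F ∷ T ∷ F ∷ T ∷ [])
  ∷ (T ∷ T ∷ T ∷ T ∷ [])
  ∷ (T ∷ F ∷ T ∷ T ∷ [])
  ∷ (T ∷ T ∷ T ∷ F ∷ [])
  ∷ (T ∷ F ∷ T ∷ F ∷ [])
  ∷ (F ∷ T ∷ F ∷ F ∷ [])
  ∷ [] )

K4-13 : AdmitsRigidOrientation 4 13
K4-13 = rigid-by-evaluation
  ( (F ∷ F ∷ T ∷ F ∷ [])
  ∷ (T ∷ F ∷ F ∷ F ∷ [])
  ∷ (T ∷ T ∷ F ∷ T ∷ [])
  ∷ (F ∷ F ∷ T ∷ T ∷ [])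
  ∷ (T ∷ F ∷ T ∷ T ∷ [])
  ∷ (F ∷ T ∷ F ∷ F ∷ [])
  ∷ (F ∷ F ∷ F ∷ F ∷ [])
  ∷ (F ∷ T ∷ T ∷ F ∷ [])
  ∷ (T ∷ T ∷ T ∷ T ∷ [])
  ∷ (T ∷ T ∷ T ∷ F ∷ [])
  ∷ (F ∷ T ∷ F ∷ T ∷ [])
  ∷ (T ∷ F ∷ T ∷ F ∷ [])
  ∷ (T ∷ F ∷ F ∷ T ∷ [])
  ∷ [] )

lemma19 : (∀ (n : ℕ) → 4 ≤ n → n ≤ 6 → AdmitsRigidOrientation 3 n)
          × (∀ (n : ℕ) → 5 ≤ n → n ≤ 13 → AdmitsRigidOrientation 4 n)
lemma19 = K₃ , K₄
  where
  K₃ : ∀ n → 4 ≤ n → n ≤ 6 → AdmitsRigidOrientation 3 n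
  K₃ 4 _ _ = K3-4
  K₃ 5 _ _ = K3-5
  K₃ 6 _ _ = K3-6
  K₃ 0 () _
  K₃ 1 (s≤s ()) _
  K₃ 2 (s≤s (s≤s ())) _
  K₃ 3 (s≤s (s≤s (s≤s ()))) _
  K₃ (suc (suc (suc (suc (suc (suc (suc _))))))) _ (s≤s (s≤s (s≤s (s≤s (s≤s (s≤s ()))))))

  K₄ : ∀ n → 5 ≤ n → n ≤ 13 → AdmitsRigidOrientation 4 n
  K₄ 5 _ _ = K4-5
  K₄ 6 _ _ = K4-6
  K₄ 7 _ _ = K4-7
  K₄ 8 _ _ = K4-8
  K₄ 9 _ _ = K4-9
  K₄ 10 _ _ = K4-10
  K₄ 11 _ _ = K4-11
  K₄ 12 _ _ = K4-12
  K₄ 13 _ _ = K4-13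
  K₄ 0 () _
  K₄ 1 (s≤s ()) _
  K₄ 2 (s≤s (s≤s ())) _
  K₄ 3 (s≤s (s≤s (s≤s ()))) _
  K₄ 4 (s≤s (s≤s (s≤s (s≤s ())))) _
  K₄ (suc (suc (suc (suc (suc (suc (suc (suc (suc (suc (suc (suc (suc (suc _)))))))))))))) _
     (s≤s (s≤s (s≤s (s≤s (s≤s (s≤s (s≤s (s≤s (s≤s (s≤s (s≤s (s≤s (s≤s ())))))))))))))
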